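{- Let $k \ge 1$ be an integer and let $G$ be a graph on $n \ge 2(k-1) + 2^{2(k-1)} + 1$ vertices. Then $G$ has an induced subgraph $H$ with $2k$ vertices that is a $k$-letter graph on the word \[ w = \ell_1 \, \ell_2 \cdots \ell_k \, \ell_k \cdots \ell_2 \, \ell_1, \] i.e., $H \cong \Gamma_D(w)$ for some decoder $D \subseteq \{\ell_1,\dots,\ell_k\}^2$. Consequently $\ell(G) \le n-k$.
   Context: For a finite alphabet $\Sigma$, a decoder is a set $D \subseteq \Sigma^2$ of ordered pairs. For a word $w = w(1)w(2)\cdots w(n)$ with letters in $\Sigma$, the letter graph $\Gamma_D(w)$ is the graph with vertex set $\{1,\dots,n\}$ and an edge between $i<j$ exactly when $(w(i),w(j)) \in D$. If $|\Sigma| = k$, $\Gamma_D(w)$ is called a $k$-letter graph. The lettericity $\ell(G)$ of a graph $G$ is the least integer $k$ such that $G$ is isomorphic to a $k$-letter graph. -}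

module Defs where

open import Data.Nat using (ℕ; _+_; _≤_)
open import Data.Bool using (Bool; true; false; if_then_else_)
open import Data.Fin using (Fin; splitAt; opposite)
open import Data.Fin.Properties using (_<?_)
open import Data.Sum using (inj₁; inj₂)
open import Data.Product using (Σ; _×_)
open import Function.Bundles using (_⤖_; Bijection)
open import Relation.Nullary.Decidable using (⌊_⌋)
open import Relation.Binary.PropositionalEquality using (_≡_)

record Graph (n : ℕ) : Set where
  field
    adj    : Fin n → Fin n → Bool
    sym    : ∀ i j → adj i j ≡ adj j i
    irrefl : ∀ i → adj i i ≡ false

Decoder : ℕ → Set
Decoder k = Fin k → Fin k → Bool

letterAdj : ∀ {k m} → Decoder k → (Fin m → Fin k) → Fin m → Fin m → Bool
letterAdj D w i j =
  if ⌊ i <? j ⌋ then D (w i) (w j)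
  else (if ⌊ j <? i ⌋ then D (w j) (w i) else false)

-- The word ℓ₁ ℓ₂ ⋯ ℓ_k ℓ_k ⋯ ℓ₂ ℓ₁ of length 2k (letters ℓ_{i+1} = i : Fin k).
palWord : (k : ℕ) → Fin (k + k) → Fin k
palWord k i with splitAt k i
... | inj₁ a = a
... | inj₂ b = opposite b

IsLetterGraph : ∀ {n} → Graph n → ℕ → Set
IsLetterGraph {n} G m =
  Σ (Fin n → Fin m) λ w → Σ (Decoder m) λ D → Σ (Fin n ⤖ Fin n) λ φ →
    ∀ i j → Graph.adj G (Bijection.to φ i) (Bijection.to φ j) ≡ letterAdj D w i j

-- ℓ(G) ≤ m  (ℓ(G) is the least such alphabet size; this is its unfolding).
LettericityAtMost : ∀ {n} → Graph n → ℕ → Set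
LettericityAtMost G m = Σ ℕ λ m' → m' ≤ m × IsLetterGraph G m'

-- Greedily pick pairs of vertices (x₁,y₁), (x₂,y₂), … such that every vertex of an
-- earlier pair sees xₛ and yₛ alike.  Given s pairs, tag every vertex by its own place
-- among the 2s chosen vertices or, if it is not chosen, by its adjacency vector to them:
-- at most 2s + 2^{2s} tags, so among more vertices two share a tag, and they are
-- unchosen twins over all chosen ones, i.e. the next pair.  With k pairs, list
-- x₁ … x_k y_k … y₁ and read the s-th pair as the letter ℓ_s: for positions i < j the
-- adjacency only depends on the letters, with D(ℓ_a, ℓ_b) = adj(x_a, y_b).  For the
-- lettericity bound, give every other vertex a letter of its own and place it between
-- the two halves of the palindrome: each ℓ_a occurs once before and once after all of
-- these vertices, so adjacency is still determined by the letters, and n − k letters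
-- suffice.
module Submission where

open import Defs
open import Data.Nat using (ℕ; _+_; _*_; _∸_; _^_; _≤_)
open import Data.Fin using (Fin)
open import Data.Product using (Σ; _×_)
open import Function.Definitions using (Injective)
open import Relation.Binary.PropositionalEquality using (_≡_)

open import Data.Bool using (Bool; false)
open import Data.Fin as Fin
  using (zero; suc; toℕ; _↑ˡ_; _↑ʳ_; splitAt; opposite; combine; remQuot; funToFin; finToFun)
open import Data.Fin.Patterns using (0F; 1F)
open import Data.Fin.Permutation as Perm using (Permutation′; _⟨$⟩ʳ_; _⟨$⟩ˡ_; _∘ₚ_)
import Data.Fin.Permutation.Components as PC
open import Data.Fin.Properties
  using ( toℕ-↑ˡ; toℕ-↑ʳ; toℕ<n; ↑ˡ-injective; ↑ʳ-injective; splitAt-↑ˡ; splitAt-↑ʳ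
        ; splitAt⁻¹-↑ˡ; splitAt⁻¹-↑ʳ; _≟_; _<?_; <-cmp; <-asym; <-irrefl; <⇒≢; any?
        ; pigeonhole; injective⇒≤; suc-injective; 0≢1+n; combine-injective; remQuot-combine
        ; finToFun-funToFin; opposite-prop; opposite-involutive; 2↔Bool )
import Data.Nat as ℕ
open import Data.Nat.Properties as ℕ
  using (+-comm; +-assoc; m+n∸n≡m; m≤n⇒∃[o]m+o≡n)
open import Data.Product using (_,_; proj₁; proj₂; ∃; ∃₂)
open import Data.Sum using (inj₁; inj₂; [_,_]′)
open import Function using (id; _∘_)
open import Function.Bundles using (Inverse)
open import Function.Properties.Inverse using (↔⇒⤖)
open import Relation.Binary.Definitions using (tri<; tri≈; tri>)
open import Relation.Binary.PropositionalEquality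
  using (_≢_; refl; sym; trans; cong; subst; subst₂; module ≡-Reasoning)
open import Relation.Nullary using (¬_; Dec; yes; no; contradiction)
open import Relation.Nullary.Decidable using (dec-true; dec-false)

data Split (m : ℕ) {n : ℕ} : Fin (m + n) → Set where
  inˡ : (i : Fin m) → Split m (i ↑ˡ n)
  inʳ : (j : Fin n) → Split m (m ↑ʳ j)

split : ∀ m {n} (i : Fin (m + n)) → Split m i
split m i with splitAt m i in eq
... | inj₁ a = subst (Split m) (splitAt⁻¹-↑ˡ eq) (inˡ a)
... | inj₂ b = subst (Split m) (splitAt⁻¹-↑ʳ eq) (inʳ b)

↑ˡ<↑ʳ : ∀ {m n} (i : Fin m) (j : Fin n) → i ↑ˡ n Fin.< m ↑ʳ j
↑ˡ<↑ʳ {m} {n} i j = subst₂ ℕ._<_ (sym (toℕ-↑ˡ i n)) (sym (toℕ-↑ʳ m j))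
  (ℕ.<-≤-trans (toℕ<n i) (ℕ.m≤m+n m (toℕ j)))

↑ˡ≢↑ʳ : ∀ {m n} (i : Fin m) (j : Fin n) → i ↑ˡ n ≢ m ↑ʳ j
↑ˡ≢↑ʳ i j = <⇒≢ (↑ˡ<↑ʳ i j)

↑ˡ-mono-< : ∀ {m} n {i j : Fin m} → i Fin.< j → i ↑ˡ n Fin.< j ↑ˡ n
↑ˡ-mono-< n {i} {j} = subst₂ ℕ._<_ (sym (toℕ-↑ˡ i n)) (sym (toℕ-↑ˡ j n))

↑ˡ-cancel-< : ∀ {m} n {i j : Fin m} → i ↑ˡ n Fin.< j ↑ˡ n → i Fin.< j
↑ˡ-cancel-< n {i} {j} = subst₂ ℕ._<_ (toℕ-↑ˡ i n) (toℕ-↑ˡ j n)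

↑ʳ-mono-< : ∀ m {n} {i j : Fin n} → i Fin.< j → m ↑ʳ i Fin.< m ↑ʳ j
↑ʳ-mono-< m {i = i} {j} i<j =
  subst₂ ℕ._<_ (sym (toℕ-↑ʳ m i)) (sym (toℕ-↑ʳ m j)) (ℕ.+-monoʳ-< m i<j)

↑ʳ-cancel-< : ∀ m {n} {i j : Fin n} → m ↑ʳ i Fin.< m ↑ʳ j → i Fin.< j
↑ʳ-cancel-< m {i = i} {j} =
  ℕ.+-cancelˡ-< m (toℕ i) (toℕ j) ∘ subst₂ ℕ._<_ (toℕ-↑ʳ m i) (toℕ-↑ʳ m j)

opposite-< : ∀ {n} {i j : Fin n} → i Fin.< j → opposite j Fin.< opposite i
opposite-< {i = i} {j} i<j =
  subst₂ ℕ._<_ (sym (opposite-prop j)) (sym (opposite-prop i)) (ℕ.∸-monoʳ-< (ℕ.s≤s i<j) (toℕ<n j))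

opposite-injective : ∀ {n} {i j : Fin n} → opposite i ≡ opposite j → i ≡ j
opposite-injective {i = i} {j} eq =
  trans (sym (opposite-involutive i)) (trans (cong opposite eq) (opposite-involutive j))

funToFin-injective : ∀ {m n} {f g : Fin m → Fin n} → funToFin f ≡ funToFin g → ∀ i → f i ≡ g i
funToFin-injective {f = f} {g} eq i =
  trans (sym (finToFun-funToFin f i)) (trans (cong (λ x → finToFun x i) eq) (finToFun-funToFin g i))

module _ {k m} (D : Decoder k) (w : Fin m → Fin k) where

  letterAdj-< : ∀ {i j} → i Fin.< j → letterAdj D w i j ≡ D (w i) (w j)
  letterAdj-< {i} {j} i<j with i <? j
  ... | yes _   = refl
  ... | no i≮j = contradiction i<j i≮j

  letterAdj-> : ∀ {i j} → j Fin.< i → letterAdj D w i j ≡ D (w j) (w i)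
  letterAdj-> {i} {j} j<i with i <? j | j <? i
  ... | yes i<j | _       = contradiction i<j (<-asym j<i)
  ... | no _    | yes _   = refl
  ... | no _    | no j≮i = contradiction j<i j≮i

  letterAdj-refl : ∀ i → letterAdj D w i i ≡ false
  letterAdj-refl i with i <? i
  ... | yes i<i = contradiction i<i (<-irrefl refl)
  ... | no _    = refl

HasInducedLetterGraph : ∀ {n m k} → Graph n → (Fin m → Fin k) → Set
HasInducedLetterGraph {n} {m} {k} G w =
  Σ (Fin m → Fin n) λ e → Injective _≡_ _≡_ e × Σ (Decoder k) λ D →
    ∀ i j → Graph.adj G (e i) (e j) ≡ letterAdj D w i j

adj≡letterAdj : ∀ {n m k} (G : Graph n) (e : Fin m → Fin n) (D : Decoder k) (w : Fin m → Fin k) →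
  (∀ {i j} → i Fin.< j → Graph.adj G (e i) (e j) ≡ D (w i) (w j)) →
  ∀ i j → Graph.adj G (e i) (e j) ≡ letterAdj D w i j
adj≡letterAdj G e D w adj-< i j with <-cmp i j
... | tri< i<j _ _  = trans (adj-< i<j) (sym (letterAdj-< D w i<j))
... | tri≈ _ refl _ = trans (Graph.irrefl G (e i)) (sym (letterAdj-refl D w i))
... | tri> _ _ j<i  =
  trans (Graph.sym G (e i) (e j)) (trans (adj-< j<i) (sym (letterAdj-> D w j<i)))

transpose-matchˡ : ∀ {n} (i j : Fin n) → PC.transpose i j i ≡ j
transpose-matchˡ i j rewrite dec-true (i ≟ i) refl = refl

transpose-fix : ∀ {n} (i j x : Fin n) → x ≢ i → x ≢ j → PC.transpose i j x ≡ x
transpose-fix i j x x≢i x≢j rewrite dec-false (x ≟ i) x≢i | dec-false (x ≟ j) x≢j = refl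

extendToPermutation : ∀ {a n} (f g : Fin a → Fin n) → Injective _≡_ _≡_ f → Injective _≡_ _≡_ g →
  Σ (Permutation′ n) λ π → ∀ i → π ⟨$⟩ʳ f i ≡ g i
extendToPermutation {ℕ.zero}  f g _ _ = Perm.id , λ ()
extendToPermutation {ℕ.suc a} {n} f g f-inj g-inj = Perm.transpose (f zero) q ∘ₚ π , π∘τ∘f≡g
  where
  onSuc : Σ (Permutation′ n) λ π → ∀ i → π ⟨$⟩ʳ f (suc i) ≡ g (suc i)
  onSuc = extendToPermutation (f ∘ suc) (g ∘ suc) (suc-injective ∘ f-inj) (suc-injective ∘ g-inj)

  π : Permutation′ n
  π = proj₁ onSuc

  π∘f≡g : ∀ i → π ⟨$⟩ʳ f (suc i) ≡ g (suc i)
  π∘f≡g = proj₂ onSuc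

  q : Fin n
  q = π ⟨$⟩ˡ g zero

  π∘τ∘f≡g : ∀ i → π ⟨$⟩ʳ PC.transpose (f zero) q (f i) ≡ g i
  π∘τ∘f≡g zero rewrite transpose-matchˡ (f zero) q = Perm.inverseʳ π
  π∘τ∘f≡g (suc i) =
    trans (cong (π ⟨$⟩ʳ_) (transpose-fix (f zero) q (f (suc i)) (0≢1+n ∘ sym ∘ f-inj) f[1+i]≢q))
          (π∘f≡g i)
    where
    f[1+i]≢q : f (suc i) ≢ q
    f[1+i]≢q eq =
      0≢1+n (g-inj (trans (sym (Perm.inverseʳ π)) (trans (cong (π ⟨$⟩ʳ_) (sym eq)) (π∘f≡g i))))

-- Chains of twin pairs

module _ {n} (G : Graph n) where
  open Graph G renaming (sym to adj-sym)

  -- Index 0 is the pair found last.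
  record TwinChain (s : ℕ) : Set where
    field
      vertex   : Fin s → Fin 2 → Fin n
      distinct : ∀ {i j c d} → vertex i c ≡ vertex j d → i ≡ j × c ≡ d
      twins    : ∀ {i j} → i Fin.< j → ∀ c →
                 adj (vertex j c) (vertex i 0F) ≡ adj (vertex j c) (vertex i 1F)

  emptyChain : TwinChain 0
  emptyChain = record { vertex = λ () ; distinct = λ { {()} } ; twins = λ { {()} } }

  module Extension {s} (C : TwinChain s) where
    open TwinChain C

    InChain : Fin n → Set
    InChain v = ∃₂ λ i c → vertex i c ≡ v

    inChain? : ∀ v → Dec (InChain v)
    inChain? v = any? λ i → any? λ c → vertex i c ≟ v

    bit : Bool → Fin 2
    bit = Inverse.from 2↔Bool

    sees : Fin n → Fin 2 × Fin s → Fin 2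
    sees v (c , i) = bit (adj (vertex i c) v)

    profile : Fin n → Fin (2 * s) → Fin 2
    profile v = sees v ∘ remQuot s

    profile-combine : ∀ v c i → profile v (combine c i) ≡ sees v (c , i)
    profile-combine v c i = cong (sees v) (remQuot-combine c i)

    signature : ∀ v → Dec (InChain v) → Fin (2 * s + 2 ^ (2 * s))
    signature v (yes (i , c , _)) = combine c i ↑ˡ 2 ^ (2 * s)
    signature v (no _)            = 2 * s ↑ʳ funToFin (profile v)

    record UnchosenTwins (x y : Fin n) : Set where
      field
        x∉ : ¬ InChain x
        y∉ : ¬ InChain y
        alike : ∀ i c → adj (vertex i c) x ≡ adj (vertex i c) y

    signature-collision : ∀ {x y} (x? : Dec (InChain x)) (y? : Dec (InChain y)) →
      x ≢ y → signature x x? ≡ signature y y? → UnchosenTwins x y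
    signature-collision (yes (i , c , refl)) (yes (j , d , refl)) x≢y eq
      with refl , refl ← combine-injective c i d j (↑ˡ-injective _ _ _ eq) = contradiction refl x≢y
    signature-collision (yes _) (no _) _ eq = contradiction eq (↑ˡ≢↑ʳ _ _)
    signature-collision (no _) (yes _) _ eq = contradiction (sym eq) (↑ˡ≢↑ʳ _ _)
    signature-collision {x} {y} (no x∉) (no y∉) _ eq = record { x∉ = x∉ ; y∉ = y∉ ; alike = alike }
      where
      same-profile : ∀ z → profile x z ≡ profile y z
      same-profile = funToFin-injective (↑ʳ-injective (2 * s) _ _ eq)
      bit-injective : ∀ {a b} → bit a ≡ bit b → a ≡ b
      bit-injective {a} {b} eq =
        trans (sym (Inverse.strictlyInverseˡ 2↔Bool a))
              (trans (cong (Inverse.to 2↔Bool) eq) (Inverse.strictlyInverseˡ 2↔Bool b))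
      alike : ∀ i c → adj (vertex i c) x ≡ adj (vertex i c) y
      alike i c = bit-injective (trans (sym (profile-combine x c i))
                                       (trans (same-profile (combine c i)) (profile-combine y c i)))

    extend : 2 * s + 2 ^ (2 * s) ℕ.< n → TwinChain (ℕ.suc s)
    extend bound = record { vertex = vertex′ ; distinct = distinct′ ; twins = twins′ }
      where
      sig : Fin n → Fin (2 * s + 2 ^ (2 * s))
      sig v = signature v (inChain? v)

      collision : ∃₂ λ x y → x Fin.< y × sig x ≡ sig y
      collision = pigeonhole bound sig

      x y : Fin n
      x = proj₁ collision
      y = proj₁ (proj₂ collision)

      x≢y : x ≢ y
      x≢y = <⇒≢ (proj₁ (proj₂ (proj₂ collision)))

      open UnchosenTwins
        (signature-collision (inChain? x) (inChain? y) x≢y (proj₂ (proj₂ (proj₂ collision))))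

      vertex′ : Fin (ℕ.suc s) → Fin 2 → Fin n
      vertex′ zero 0F   = x
      vertex′ zero 1F   = y
      vertex′ (suc i) c = vertex i c

      distinct′ : ∀ {i j c d} → vertex′ i c ≡ vertex′ j d → i ≡ j × c ≡ d
      distinct′ {zero}  {zero}  {0F} {0F} _  = refl , refl
      distinct′ {zero}  {zero}  {1F} {1F} _  = refl , refl
      distinct′ {zero}  {zero}  {0F} {1F} eq = contradiction eq x≢y
      distinct′ {zero}  {zero}  {1F} {0F} eq = contradiction (sym eq) x≢y
      distinct′ {zero}  {suc j} {0F} {d}  eq = contradiction (j , d , sym eq) x∉
      distinct′ {zero}  {suc j} {1F} {d}  eq = contradiction (j , d , sym eq) y∉
      distinct′ {suc i} {zero}  {c}  {0F} eq = contradiction (i , c , eq) x∉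
      distinct′ {suc i} {zero}  {c}  {1F} eq = contradiction (i , c , eq) y∉
      distinct′ {suc i} {suc j} eq with refl , refl ← distinct eq = refl , refl

      twins′ : ∀ {i j} → i Fin.< j → ∀ c →
               adj (vertex′ j c) (vertex′ i 0F) ≡ adj (vertex′ j c) (vertex′ i 1F)
      twins′ {zero}  {suc j} _           c = alike j c
      twins′ {suc i} {suc j} (ℕ.s≤s i<j) c = twins i<j c

  twinChain : ∀ s → 2 * s + 2 ^ (2 * s) ℕ.< n → TwinChain (ℕ.suc s)
  twinChain ℕ.zero    bound = Extension.extend emptyChain bound
  twinChain (ℕ.suc s) bound = Extension.extend (twinChain s (ℕ.≤-<-trans bound-mono bound)) bound
    where
    2s≤2[1+s] : 2 * s ≤ 2 * ℕ.suc s
    2s≤2[1+s] = ℕ.*-monoʳ-≤ 2 (ℕ.n≤1+n s)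
    bound-mono : 2 * s + 2 ^ (2 * s) ≤ 2 * ℕ.suc s + 2 ^ (2 * ℕ.suc s)
    bound-mono = ℕ.+-mono-≤ 2s≤2[1+s] (ℕ.^-monoʳ-≤ 2 2s≤2[1+s])

palWord-↑ˡ : ∀ {k} (a : Fin k) → palWord k (a ↑ˡ k) ≡ a
palWord-↑ˡ {k} a rewrite splitAt-↑ˡ k a k = refl

palWord-↑ʳ : ∀ {k} (b : Fin k) → palWord k (k ↑ʳ b) ≡ opposite b
palWord-↑ʳ {k} b rewrite splitAt-↑ʳ k k b = refl

module _ {n} (G : Graph n) where
  open Graph G renaming (sym to adj-sym)

  twinChain⇒palindrome : ∀ {k} → TwinChain G k → HasInducedLetterGraph G (palWord k)
  twinChain⇒palindrome {k} C = e , e-injective , D , adj≡letterAdj G e D (palWord k) adj-<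
    where
    open TwinChain C

    -- The letter a is carried by the pair of index (opposite a).
    e : Fin (k + k) → Fin n
    e x = [ (λ a → vertex (opposite a) 0F) , (λ b → vertex b 1F) ]′ (splitAt k x)

    D : Decoder k
    D a b = adj (vertex (opposite a) 0F) (vertex (opposite b) 1F)

    e-↑ˡ : ∀ a → e (a ↑ˡ k) ≡ vertex (opposite a) 0F
    e-↑ˡ a rewrite splitAt-↑ˡ k a k = refl

    e-↑ʳ : ∀ b → e (k ↑ʳ b) ≡ vertex b 1F
    e-↑ʳ b rewrite splitAt-↑ʳ k k b = refl

    e-injective : Injective _≡_ _≡_ e
    e-injective {x} {y} eq with split k x | split k y
    ... | inˡ a | inˡ b rewrite e-↑ˡ a | e-↑ˡ b =
      cong (_↑ˡ k) (opposite-injective (proj₁ (distinct eq)))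
    ... | inˡ a | inʳ b rewrite e-↑ˡ a | e-↑ʳ b with () ← proj₂ (distinct eq)
    ... | inʳ a | inˡ b rewrite e-↑ʳ a | e-↑ˡ b with () ← proj₂ (distinct eq)
    ... | inʳ a | inʳ b rewrite e-↑ʳ a | e-↑ʳ b = cong (k ↑ʳ_) (proj₁ (distinct eq))

    adj-< : ∀ {x y} → x Fin.< y → adj (e x) (e y) ≡ D (palWord k x) (palWord k y)
    adj-< {x} {y} x<y with split k x | split k y
    ... | inˡ a | inˡ b rewrite e-↑ˡ a | e-↑ˡ b | palWord-↑ˡ a | palWord-↑ˡ b =
      twins (opposite-< (↑ˡ-cancel-< k x<y)) 0F
    ... | inˡ a | inʳ b
      rewrite e-↑ˡ a | e-↑ʳ b | palWord-↑ˡ a | palWord-↑ʳ b | opposite-involutive b = refl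
    ... | inʳ a | inˡ b = contradiction (↑ˡ<↑ʳ b a) (<-asym x<y)
    ... | inʳ a | inʳ b
      rewrite e-↑ʳ a | e-↑ʳ b | palWord-↑ʳ a | palWord-↑ʳ b
            | opposite-involutive a | opposite-involutive b =
      begin
        adj (vertex a 1F) (vertex b 1F) ≡⟨ adj-sym _ _ ⟩
        adj (vertex b 1F) (vertex a 1F) ≡⟨ twins (↑ʳ-cancel-< k x<y) 1F ⟨
        adj (vertex b 1F) (vertex a 0F) ≡⟨ adj-sym _ _ ⟩
        adj (vertex a 0F) (vertex b 1F) ∎
      where open ≡-Reasoning

-- From an induced palindrome to a letter representation of G

data Block (k mid : ℕ) : Fin ((k + mid) + k) → Set where
  front  : (a : Fin k)   → Block k mid ((a ↑ˡ mid) ↑ˡ k)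
  middle : (c : Fin mid) → Block k mid ((k ↑ʳ c) ↑ˡ k)
  back   : (b : Fin k)   → Block k mid ((k + mid) ↑ʳ b)

block : ∀ {k mid} (i : Fin ((k + mid) + k)) → Block k mid i
block {k} {mid} i with split (k + mid) i
... | inʳ b = back b
... | inˡ l with split k l
...   | inˡ a = front a
...   | inʳ c = middle c

module _ {k mid : ℕ} where

  -- The first k + mid positions spell every letter once, the last k spell ℓ_k ⋯ ℓ₁ again;
  -- each middle position has a letter of its own.
  word : Fin ((k + mid) + k) → Fin (k + mid)
  word i = [ id , (λ b → opposite b ↑ˡ mid) ]′ (splitAt (k + mid) i)

  lastOccurrence : Fin (k + mid) → Fin ((k + mid) + k)
  lastOccurrence l =
    [ (λ a → (k + mid) ↑ʳ opposite a) , (λ c → (k ↑ʳ c) ↑ˡ k) ]′ (splitAt k l)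

  outer : Fin (k + k) → Fin ((k + mid) + k)
  outer x = [ (λ a → (a ↑ˡ mid) ↑ˡ k) , ((k + mid) ↑ʳ_) ]′ (splitAt k x)

  word-↑ˡ : ∀ l → word (l ↑ˡ k) ≡ l
  word-↑ˡ l rewrite splitAt-↑ˡ (k + mid) l k = refl

  word-↑ʳ : ∀ b → word ((k + mid) ↑ʳ b) ≡ opposite b ↑ˡ mid
  word-↑ʳ b rewrite splitAt-↑ʳ (k + mid) k b = refl

  lastOccurrence-front : ∀ a → lastOccurrence (a ↑ˡ mid) ≡ (k + mid) ↑ʳ opposite a
  lastOccurrence-front a rewrite splitAt-↑ˡ k a mid = refl

  lastOccurrence-middle : ∀ c → lastOccurrence (k ↑ʳ c) ≡ (k ↑ʳ c) ↑ˡ k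
  lastOccurrence-middle c rewrite splitAt-↑ʳ k mid c = refl

  outer-↑ˡ : ∀ a → outer (a ↑ˡ k) ≡ (a ↑ˡ mid) ↑ˡ k
  outer-↑ˡ a rewrite splitAt-↑ˡ k a k = refl

  outer-↑ʳ : ∀ b → outer (k ↑ʳ b) ≡ (k + mid) ↑ʳ b
  outer-↑ʳ b rewrite splitAt-↑ʳ k k b = refl

  outer-injective : Injective _≡_ _≡_ outer
  outer-injective {x} {y} eq with split k x | split k y
  ... | inˡ a | inˡ b rewrite outer-↑ˡ a | outer-↑ˡ b =
    cong (_↑ˡ k) (↑ˡ-injective mid a b (↑ˡ-injective k _ _ eq))
  ... | inˡ a | inʳ b rewrite outer-↑ˡ a | outer-↑ʳ b = contradiction eq (↑ˡ≢↑ʳ _ _)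
  ... | inʳ a | inˡ b rewrite outer-↑ʳ a | outer-↑ˡ b = contradiction (sym eq) (↑ˡ≢↑ʳ _ _)
  ... | inʳ a | inʳ b rewrite outer-↑ʳ a | outer-↑ʳ b = cong (k ↑ʳ_) (↑ʳ-injective (k + mid) a b eq)

  palindrome⇒letterGraph : (G : Graph ((k + mid) + k)) → HasInducedLetterGraph G (palWord k) →
    IsLetterGraph G (k + mid)
  palindrome⇒letterGraph G (e , e-injective , D , e-letterAdj) =
    word , D′ , ↔⇒⤖ π , adj≡letterAdj G φ D′ word adj-<
    where
    open Graph G using (adj)

    π : Permutation′ ((k + mid) + k)
    π = proj₁ (extendToPermutation outer e outer-injective e-injective)

    φ : Fin ((k + mid) + k) → Fin ((k + mid) + k)
    φ = π ⟨$⟩ʳ_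

    φ∘outer≡e : ∀ x → φ (outer x) ≡ e x
    φ∘outer≡e = proj₂ (extendToPermutation outer e outer-injective e-injective)

    φ-front : ∀ a → φ ((a ↑ˡ mid) ↑ˡ k) ≡ e (a ↑ˡ k)
    φ-front a = trans (cong φ (sym (outer-↑ˡ a))) (φ∘outer≡e (a ↑ˡ k))

    φ-back : ∀ b → φ ((k + mid) ↑ʳ b) ≡ e (k ↑ʳ b)
    φ-back b = trans (cong φ (sym (outer-↑ʳ b))) (φ∘outer≡e (k ↑ʳ b))

    D′ : Decoder (k + mid)
    D′ l l′ = adj (φ (l ↑ˡ k)) (φ (lastOccurrence l′))

    palindrome-< : ∀ {x y} → x Fin.< y → adj (e x) (e y) ≡ D (palWord k x) (palWord k y)
    palindrome-< {x} {y} x<y = trans (e-letterAdj x y) (letterAdj-< D (palWord k) x<y)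

    D′-outer : ∀ a b → D′ (a ↑ˡ mid) (b ↑ˡ mid) ≡ D a b
    D′-outer a b
      rewrite lastOccurrence-front b | φ-front a | φ-back (opposite b)
            | palindrome-< (↑ˡ<↑ʳ a (opposite b)) | palWord-↑ˡ a | palWord-↑ʳ (opposite b)
            | opposite-involutive b = refl

    adj-< : ∀ {i j} → i Fin.< j → adj (φ i) (φ j) ≡ D′ (word i) (word j)
    adj-< {i} {j} i<j with block {k} {mid} i | block {k} {mid} j
    ... | front a | front b
      rewrite word-↑ˡ (a ↑ˡ mid) | word-↑ˡ (b ↑ˡ mid) | D′-outer a b | φ-front a | φ-front b
            | palindrome-< (↑ˡ-mono-< k (↑ˡ-cancel-< mid (↑ˡ-cancel-< k i<j)))
            | palWord-↑ˡ a | palWord-↑ˡ b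
      = refl
    ... | front a | middle c
      rewrite word-↑ˡ (a ↑ˡ mid) | word-↑ˡ (k ↑ʳ c) | lastOccurrence-middle c = refl
    ... | front a | back b
      rewrite word-↑ˡ (a ↑ˡ mid) | word-↑ʳ b | lastOccurrence-front (opposite b)
            | opposite-involutive b = refl
    ... | middle c | front a = contradiction (↑ˡ-cancel-< k i<j) (<-asym (↑ˡ<↑ʳ a c))
    ... | middle c | middle c′
      rewrite word-↑ˡ (k ↑ʳ c) | word-↑ˡ (k ↑ʳ c′) | lastOccurrence-middle c′ = refl
    ... | middle c | back b
      rewrite word-↑ˡ (k ↑ʳ c) | word-↑ʳ b | lastOccurrence-front (opposite b)
            | opposite-involutive b = refl
    ... | back b | front a = contradiction (↑ˡ<↑ʳ _ b) (<-asym i<j)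
    ... | back b | middle c = contradiction (↑ˡ<↑ʳ _ b) (<-asym i<j)
    ... | back b | back b′
      rewrite word-↑ʳ b | word-↑ʳ b′ | D′-outer (opposite b) (opposite b′) | φ-back b | φ-back b′
            | palindrome-< (↑ʳ-mono-< k (↑ʳ-cancel-< (k + mid) i<j))
            | palWord-↑ʳ b | palWord-↑ʳ b′
      = refl

palindrome⇒lettericity : ∀ {n k} (G : Graph n) → HasInducedLetterGraph G (palWord k) →
  LettericityAtMost G (n ∸ k)
palindrome⇒lettericity {n} {k} G H@(e , e-injective , _) =
  fromSplitting (split-around-palindrome (injective⇒≤ e-injective)) G H
  where
  split-around-palindrome : k + k ≤ n → ∃ λ mid → (k + mid) + k ≡ n
  split-around-palindrome k+k≤n with o , k+k+o≡n ← m≤n⇒∃[o]m+o≡n k+k≤n = o , (begin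
    (k + o) + k ≡⟨ +-assoc k o k ⟩
    k + (o + k) ≡⟨ cong (k +_) (+-comm o k) ⟩
    k + (k + o) ≡⟨ +-assoc k k o ⟨
    (k + k) + o ≡⟨ k+k+o≡n ⟩
    n           ∎)
    where open ≡-Reasoning

  fromSplitting : ∀ {n} → ∃ (λ mid → (k + mid) + k ≡ n) → (G : Graph n) →
    HasInducedLetterGraph G (palWord k) → LettericityAtMost G (n ∸ k)
  fromSplitting (mid , refl) G H =
    k + mid , ℕ.≤-reflexive (sym (m+n∸n≡m (k + mid) k)) , palindrome⇒letterGraph G H

theorem3 : (k n : ℕ) → 1 ≤ k → 2 * (k ∸ 1) + 2 ^ (2 * (k ∸ 1)) + 1 ≤ n → (G : Graph n) →
    (Σ (Fin (k + k) → Fin n) λ e → Injective _≡_ _≡_ e × Σ (Decoder k) λ D →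
        ∀ i j → Graph.adj G (e i) (e j) ≡ letterAdj D (palWord k) i j)
    × LettericityAtMost G (n ∸ k)
theorem3 (ℕ.suc m) n (ℕ.s≤s ℕ.z≤n) bound G = palindrome , palindrome⇒lettericity G palindrome
  where
  palindrome : HasInducedLetterGraph G (palWord (ℕ.suc m))
  palindrome = twinChain⇒palindrome G (twinChain G m (subst (_≤ n) (+-comm _ 1) bound))
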